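{- Let $t\ge1$ be an integer, and let $\pi_1,\pi_2,\dots$ be the permutations of $[t]^8$ defined by $\pi_i=\pi(u^{(i)})$, where $u^{(i)}=u^{(i\bmod 8)}$ (with $u^{(0)}=u^{(8)}$) and \begin{align*} u^{(1)}&=(+,+,+,+,+,+,+,+), & u^{(2)}&=(-,-,-,+,-,+,-,-),\\ u^{(3)}&=(+,+,+,-,-,-,-,+), & u^{(4)}&=(-,+,-,-,+,+,+,-),\\ u^{(5)}&=(+,-,-,+,-,-,+,+), & u^{(6)}&=(-,+,+,+,+,-,-,-),\\ u^{(7)}&=(+,-,-,-,+,+,-,+), & u^{(8)}&=(-,-,+,-,-,-,+,-). \end{align*} Then for all positive integers $i,j,\ell$: (a) $\mathrm{LCS}(\pi_i,\pi_{i+1})\leq t^2$; (b) $\mathrm{LCS}(\pi_i,\pi_j)\leq t^4$ if $\pi_i\neq\pi_j$; (c) $\mathrm{LCS}(\pi_i,\pi_{i+1},\pi_{i+2})=1$; (d) $\mathrm{LCS}(\pi_i,\pi_{i+1},\pi_j)\leq t$ if $\pi_j\notin\{\pi_i,\pi_{i+1}\}$; (e) $\mathrm{LCS}(\pi_i,\pi_j,\pi_\ell)\leq t^2$ if $\pi_i,\pi_j,\pi_\ell$ are distinct; (f) if $j\in[3]$ and $x$ is a common subsequence of $\pi_i$ and $\pi_{i+j}$ such that $x[\ell]_{\leq 6}$ is the same for all positions $\ell$ of $x$, then $|x|\leq t$; (g) if $j\in[7]$ and $x$ is a common subsequence of $\pi_i$ and $\pi_{i+j}$ such that $x[\ell]_{\leq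 5}$ is the same for all positions $\ell$, then $|x|\leq t^2$; (h) if $j\in[7]$ and $x$ is a common subsequence of $\pi_i$ and $\pi_{i+j}$ such that $x[\ell]_{\leq 3}$ is the same for all positions $\ell$, then $|x|\leq t^3$.
   Context: For $u\in\{+,-\}^8$ (signs viewed as $\pm1$) and $a\in[t]^8$, let $ua=(u_1a_1,\dots,u_8a_8)$. The permutation $\pi(u)$ is the word over the alphabet $[t]^8$ containing each symbol of $[t]^8$ exactly once, in which $a$ precedes $b$ iff $ua$ is lexicographically smaller than $ub$. $\mathrm{LCS}$ of a collection of words is the length of their longest common subsequence. For a word $x$, $x[\ell]$ is its $\ell$-th symbol, and for $p\in[t]^8$, $p_{\leq j}=(p_1,\dots,p_j)$. -}

module Defs where

open import Data.Nat using (ℕ; zero; suc; _≤_)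
open import Data.Nat.DivMod using (_mod_)
open import Data.Fin using (Fin; zero; suc)
open import Data.Fin.Base using () renaming (zero to f0)
open import Data.List using (List; []; _∷_; [_]; map; concatMap; reverse; allFin; length)
open import Data.List.Relation.Unary.All using (All)
open import Data.List.Relation.Binary.Sublist.Propositional using (_⊆_)
open import Data.List.Membership.Propositional using (_∈_)
open import Data.Vec using (Vec; []; _∷_; take)
open import Relation.Binary.PropositionalEquality using (_≡_)

data Sign : Set where
  pos neg : Sign

-- Symbols of [t]^n : we use Fin t = {0,…,t-1} in place of [t] = {1,…,t}
-- (an order-preserving relabelling).
Sym : ℕ → ℕ → Set
Sym t n = Vec (Fin t) n

coordOrder : (t : ℕ) → Sign → List (Fin t)
coordOrder t pos = allFin t
coordOrder t neg = reverse (allFin t)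

-- π(u) : the word containing every symbol of [t]^n exactly once, listed in
-- lexicographic order of u·a (lex order = first coordinate most significant).
πw : (t : ℕ) {n : ℕ} → Vec Sign n → List (Sym t n)
πw t []       = [ [] ]
πw t (s ∷ us) = concatMap (λ c → map (c ∷_) (πw t us)) (coordOrder t s)

-- The eight sign vectors; index 0 holds u^(8) (so that u^(0) = u^(8)).
U : Fin 8 → Vec Sign 8
U zero                                   = neg ∷ neg ∷ pos ∷ neg ∷ neg ∷ neg ∷ pos ∷ neg ∷ []
U (suc zero)                             = pos ∷ pos ∷ pos ∷ pos ∷ pos ∷ pos ∷ pos ∷ pos ∷ []
U (suc (suc zero))                       = neg ∷ neg ∷ neg ∷ pos ∷ neg ∷ pos ∷ neg ∷ neg ∷ []
U (suc (suc (suc zero)))                 = pos ∷ pos ∷ pos ∷ neg ∷ neg ∷ neg ∷ neg ∷ pos ∷ []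
U (suc (suc (suc (suc zero))))           = neg ∷ pos ∷ neg ∷ neg ∷ pos ∷ pos ∷ pos ∷ neg ∷ []
U (suc (suc (suc (suc (suc zero)))))     = pos ∷ neg ∷ neg ∷ pos ∷ neg ∷ neg ∷ pos ∷ pos ∷ []
U (suc (suc (suc (suc (suc (suc zero)))))) = neg ∷ pos ∷ pos ∷ pos ∷ pos ∷ neg ∷ neg ∷ neg ∷ []
U (suc (suc (suc (suc (suc (suc (suc zero))))))) = pos ∷ neg ∷ neg ∷ neg ∷ pos ∷ pos ∷ neg ∷ pos ∷ []

u : ℕ → Vec Sign 8
u i = U (i mod 8)

πseq : (t : ℕ) → ℕ → List (Sym t 8)
πseq t i = πw t (u i)

CommonSubseq : {A : Set} → List A → List (List A) → Set
CommonSubseq x ws = All (x ⊆_) ws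

LCS≤ : {A : Set} → List (List A) → ℕ → Set
LCS≤ ws b = ∀ x → CommonSubseq x ws → length x ≤ b

SamePrefix : {t : ℕ} (k : ℕ) {m : ℕ} → List (Vec (Fin t) (k Data.Nat.+ m)) → Set
SamePrefix k {m} x = ∀ {a b} → a ∈ x → b ∈ x → take k {m} a ≡ take k {m} b

-- A common subsequence of π(v₁), …, π(vₘ) is strictly increasing for each of the
-- lexicographic orders given by the sign vectors vᵢ. Look at the first coordinate: if two
-- of the vᵢ disagree there, two symbols of the subsequence with different first
-- coordinates would be ordered oppositely by them, so all symbols share that coordinate;
-- if all vᵢ agree, the symbols split into at most t classes by their first coordinate.
-- Inducting on the coordinates, a common subsequence has at most t^e symbols, where e
-- counts the coordinates (after a prefix on which the symbols are known to agree) where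
-- all vᵢ carry the same sign. Every part of the theorem is then a bound on e for the
-- eight sign vectors, checked by evaluation.

module Submission where

open import Defs
open import Data.Nat using (ℕ; zero; suc; _+_; _*_; _^_; _≤_; _<_; _≤?_; z≤n; s≤s; >-nonZero)
open import Data.Nat.Properties
  using (+-mono-≤; ≤-trans; ^-monoʳ-≤; ^-identityʳ; +-0-commutativeMonoid; allUpTo?)
open import Data.Nat.DivMod using (_%_; m%n<n; m%n%n≡m%n; %-distribˡ-+)
open import Data.Fin as Fin using (Fin; zero; suc; fromℕ<)
import Data.Fin.Properties as Finₚ
open import Data.Vec using (Vec; []; _∷_; head; tail; take; replicate)
open import Data.Vec.Properties using (∷-injective; ≡-dec)
open import Data.List using (List; []; _∷_; [_]; length; map; filter; reverse)
open import Data.List.Properties using (unfold-reverse; length-map)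
open import Data.List.Relation.Unary.All as All using (All; []; _∷_; all?)
import Data.List.Relation.Unary.All.Properties as All
open import Data.List.Relation.Unary.AllPairs as AllPairs using (AllPairs; []; _∷_)
import Data.List.Relation.Unary.AllPairs.Properties as AllPairs
open import Data.List.Relation.Unary.Any as Any using (here; there)
import Data.List.Relation.Unary.Any.Properties as Any
open import Data.List.Membership.Propositional using (_∈_)
open import Data.List.Membership.Propositional.Properties using (∈-allFin; ∈-map⁺; ∈-concatMap⁺; ∈-filter⁻)
open import Data.List.Relation.Binary.Sublist.Propositional using (_⊆_; []; _∷_; _∷ʳ_; from∈)
open import Data.List.Relation.Binary.Sublist.Propositional.Properties using (All-resp-⊆)
open import Algebra.Properties.CommutativeMonoid.Sum +-0-commutativeMonoid
  using (sum; ∑-distrib-+; sum-cong-≗; sum-replicate-zero)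
open import Data.Bool using (if_then_else_)
open import Data.Product using (_×_; _,_; proj₁; proj₂; ∃; uncurry)
open import Data.Sum using (_⊎_; inj₁; inj₂)
open import Data.Empty using (⊥; ⊥-elim)
open import Function using (_∘_; flip)
open import Relation.Nullary using (¬_; yes; no; does; ¬?)
open import Relation.Nullary.Decidable using (from-yes; _→-dec_)
open import Relation.Binary.Definitions using (DecidableEquality)
open import Relation.Binary.PropositionalEquality
  using (_≡_; _≢_; refl; sym; trans; cong; cong₂; subst; module ≡-Reasoning)

_≟ˢ_ : DecidableEquality Sign
pos ≟ˢ pos = yes refl
pos ≟ˢ neg = no λ ()
neg ≟ˢ pos = no λ ()
neg ≟ˢ neg = yes refl

module _ {A : Set} {R : A → A → Set} where

  AllPairs-reverse : ∀ {xs} → AllPairs (flip R) xs → AllPairs R (reverse xs)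
  AllPairs-reverse {[]}     []       = []
  AllPairs-reverse {x ∷ xs} (p ∷ ps) rewrite unfold-reverse x xs =
    AllPairs.++⁺ (AllPairs-reverse ps) ([] ∷ [])
      (All.tabulate (λ y∈ → All.lookup p (Any.reverse⁻ y∈) ∷ []))

  AllPairs-resp-⊇ : ∀ {xs ys} → xs ⊆ ys → AllPairs R ys → AllPairs R xs
  AllPairs-resp-⊇ []         []       = []
  AllPairs-resp-⊇ (_ ∷ʳ τ)   (_ ∷ ps) = AllPairs-resp-⊇ τ ps
  AllPairs-resp-⊇ (refl ∷ τ) (p ∷ ps) = All-resp-⊆ τ p ∷ AllPairs-resp-⊇ τ ps

  AllPairs-tabulate : ∀ {xs} → (∀ {a b} → a ∈ xs → b ∈ xs → R a b) → AllPairs R xs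
  AllPairs-tabulate {[]}     r = []
  AllPairs-tabulate {x ∷ xs} r =
    All.tabulate (r (here refl) ∘ there) ∷ AllPairs-tabulate (λ a∈ b∈ → r (there a∈) (there b∈))

take-suc-≡⁻ : ∀ {A : Set} k {m} {a b : Vec A (suc k + m)} →
  take (suc k) a ≡ take (suc k) b → head a ≡ head b × take k (tail a) ≡ take k (tail b)
take-suc-≡⁻ k {a = _ ∷ _} {_ ∷ _} = ∷-injective

module _ {A : Set} {t : ℕ} (key : A → Fin t) where

  fibre : Fin t → List A → List A
  fibre c = filter (λ a → key a Fin.≟ c)

  private
    indicator : ∀ {n} → Fin n → Fin n → ℕ
    indicator a c = if does (a Fin.≟ c) then 1 else 0

    sum-indicator : ∀ {n} (a : Fin n) → sum (indicator a) ≡ 1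
    sum-indicator {suc n} zero    = cong suc (sum-replicate-zero n)
    sum-indicator {suc n} (suc a) = sum-indicator a

    length-fibre-∷ : ∀ a x c → length (fibre c (a ∷ x)) ≡ indicator (key a) c + length (fibre c x)
    length-fibre-∷ a x c with key a Fin.≟ c
    ... | yes _ = refl
    ... | no  _ = refl

    sum-≤-* : ∀ {n B} (f : Fin n → ℕ) → (∀ c → f c ≤ B) → sum f ≤ n * B
    sum-≤-* {zero}  f f≤B = z≤n
    sum-≤-* {suc n} f f≤B = +-mono-≤ (f≤B zero) (sum-≤-* (f ∘ suc) (f≤B ∘ suc))

  length≡sum-fibres : ∀ x → length x ≡ sum (λ c → length (fibre c x))
  length≡sum-fibres []      = sym (sum-replicate-zero t)
  length≡sum-fibres (a ∷ x) = begin
    suc (length x)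
      ≡⟨ cong₂ _+_ (sym (sum-indicator (key a))) (length≡sum-fibres x) ⟩
    sum (indicator (key a)) + sum (λ c → length (fibre c x))
      ≡⟨ sym (∑-distrib-+ (indicator (key a)) _) ⟩
    sum (λ c → indicator (key a) c + length (fibre c x))
      ≡⟨ sum-cong-≗ (sym ∘ length-fibre-∷ a x) ⟩
    sum (λ c → length (fibre c (a ∷ x))) ∎
    where open ≡-Reasoning

  fibre-sameKey : ∀ c x → AllPairs (λ a b → key a ≡ key b) (fibre c x)
  fibre-sameKey c x = AllPairs-tabulate λ a∈ b∈ →
    trans (proj₂ (∈-filter⁻ (λ a → key a Fin.≟ c) {xs = x} a∈))
          (sym (proj₂ (∈-filter⁻ (λ a → key a Fin.≟ c) {xs = x} b∈)))

  length-≤-fibres : ∀ {B} x → (∀ c → length (fibre c x) ≤ B) → length x ≤ t * B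
  length-≤-fibres {B} x fibre≤B =
    subst (_≤ t * B) (sym (length≡sum-fibres x)) (sum-≤-* _ fibre≤B)

SignedLess : {t : ℕ} → Sign → Fin t → Fin t → Set
SignedLess pos a b = a Fin.< b
SignedLess neg a b = b Fin.< a

LexLess : {t n : ℕ} → Vec Sign n → Vec (Fin t) n → Vec (Fin t) n → Set
LexLess []      []       []       = ⊥
LexLess (s ∷ v) (a ∷ as) (b ∷ bs) = SignedLess s a b ⊎ (a ≡ b × LexLess v as bs)

IncreasingFor : {t n : ℕ} → List (Vec Sign n) → List (Vec (Fin t) n) → Set
IncreasingFor vs x = All (λ w → AllPairs (LexLess w) x) vs

SameHeads : {t n : ℕ} → List (Vec (Fin t) (suc n)) → Set
SameHeads = AllPairs (λ a b → head a ≡ head b)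

module _ {t : ℕ} where

  SignedLess-irrefl : ∀ s {a : Fin t} → ¬ SignedLess s a a
  SignedLess-irrefl pos = Finₚ.<-irrefl refl
  SignedLess-irrefl neg = Finₚ.<-irrefl refl

  SignedLess-opposite : ∀ {s s'} {a b : Fin t} → s ≢ s' → SignedLess s a b → ¬ SignedLess s' a b
  SignedLess-opposite {pos} {pos} s≢s' _ _ = s≢s' refl
  SignedLess-opposite {pos} {neg} _ a<b b<a = Finₚ.<-asym a<b b<a
  SignedLess-opposite {neg} {pos} _ b<a a<b = Finₚ.<-asym a<b b<a
  SignedLess-opposite {neg} {neg} s≢s' _ _ = s≢s' refl

  LexLess-tail : ∀ {n} (w : Vec Sign (suc n)) {a b : Vec (Fin t) (suc n)} →
    head a ≡ head b → LexLess w a b → LexLess (tail w) (tail a) (tail b)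
  LexLess-tail (s ∷ _) {_ ∷ _} {_ ∷ _} refl (inj₁ lt)      = ⊥-elim (SignedLess-irrefl s lt)
  LexLess-tail (s ∷ _) {_ ∷ _} {_ ∷ _} refl (inj₂ (_ , lt)) = lt

  LexLess-opposite⇒head-≡ : ∀ {n} (w w' : Vec Sign (suc n)) {a b : Vec (Fin t) (suc n)} →
    head w ≢ head w' → LexLess w a b → LexLess w' a b → head a ≡ head b
  LexLess-opposite⇒head-≡ (_ ∷ _) (_ ∷ _) {_ ∷ _} {_ ∷ _} _ (inj₂ (eq , _)) _ = eq
  LexLess-opposite⇒head-≡ (_ ∷ _) (_ ∷ _) {_ ∷ _} {_ ∷ _} _ (inj₁ _) (inj₂ (eq , _)) = eq
  LexLess-opposite⇒head-≡ (_ ∷ _) (_ ∷ _) {_ ∷ _} {_ ∷ _} s≢s' (inj₁ lt) (inj₁ lt') =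
    ⊥-elim (SignedLess-opposite s≢s' lt lt')

  IncreasingFor-tail : ∀ {n} vs {x : List (Vec (Fin t) (suc n))} →
    SameHeads x → IncreasingFor vs x → IncreasingFor (map tail vs) (map tail x)
  IncreasingFor-tail vs same increasing = All.map⁺
    (All.map (λ {w} inc → AllPairs.map⁺ (AllPairs.zipWith (uncurry (LexLess-tail w)) (same , inc)))
      increasing)

  coordOrder-increasing : ∀ s → AllPairs (SignedLess s) (coordOrder t s)
  coordOrder-increasing pos = AllPairs.tabulate⁺-< (λ i<j → i<j)
  coordOrder-increasing neg = AllPairs-reverse (AllPairs.tabulate⁺-< (λ i<j → i<j))

  πw-increasing : ∀ {n} (v : Vec Sign n) → AllPairs (LexLess v) (πw t v)
  πw-increasing []      = [] ∷ []
  πw-increasing (s ∷ v) = AllPairs.concat⁺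
    (All.map⁺ (All.universal (λ _ → block-increasing) (coordOrder t s)))
    (AllPairs.map⁺ (AllPairs.map blocks-ordered (coordOrder-increasing s)))
    where
    block : Fin t → List (Vec (Fin t) _)
    block c = map (c ∷_) (πw t v)

    block-increasing : ∀ {c} → AllPairs (LexLess (s ∷ v)) (block c)
    block-increasing = AllPairs.map⁺ (AllPairs.map (λ lt → inj₂ (refl , lt)) (πw-increasing v))

    blocks-ordered : ∀ {c c'} → SignedLess s c c' →
      All (λ a → All (LexLess (s ∷ v) a) (block c')) (block c)
    blocks-ordered lt = All.map⁺ (All.universal (λ _ → All.map⁺ (All.universal (λ _ → inj₁ lt) _)) _)

  ∈-coordOrder : ∀ s (c : Fin t) → c ∈ coordOrder t s
  ∈-coordOrder pos c = ∈-allFin c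
  ∈-coordOrder neg c = Any.reverse⁺ (∈-allFin c)

  ∈-πw : ∀ {n} (v : Vec Sign n) a → a ∈ πw t v
  ∈-πw []      []       = here refl
  ∈-πw (s ∷ v) (c ∷ as) =
    ∈-concatMap⁺ (λ c' → map (c' ∷_) (πw t v))
      (Any.map (λ { refl → ∈-map⁺ (c ∷_) (∈-πw v as) }) (∈-coordOrder s c))

  commonSubseq⇒increasing : ∀ {n} (vs : List (Vec Sign n)) {x} →
    CommonSubseq x (map (πw t) vs) → IncreasingFor vs x
  commonSubseq⇒increasing vs common =
    All.map (λ {w} x⊆πw → AllPairs-resp-⊇ x⊆πw (πw-increasing w)) (All.map⁻ common)

sharedSigns : ∀ {n} → Vec Sign n → List (Vec Sign n) → ℕ
sharedSigns []      ws = 0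
sharedSigns (s ∷ v) ws with all? (λ w → head w ≟ˢ s) ws
... | yes _ = suc (sharedSigns v (map tail ws))
... | no  _ = sharedSigns v (map tail ws)

sharedSignsAfter : (k : ℕ) {m : ℕ} → Vec Sign (k + m) → List (Vec Sign (k + m)) → ℕ
sharedSignsAfter zero    v ws = sharedSigns v ws
sharedSignsAfter (suc k) v ws = sharedSignsAfter k (tail v) (map tail ws)

module _ {t : ℕ} where

  length-≤-via-tails : ∀ {n B} (vs : List (Vec Sign (suc n))) {y : List (Vec (Fin t) (suc n))} →
    (IncreasingFor (map tail vs) (map tail y) → length (map tail y) ≤ B) →
    SameHeads y → IncreasingFor vs y → length y ≤ B
  length-≤-via-tails vs {y} bound same inc =
    subst (_≤ _) (length-map tail y) (bound (IncreasingFor-tail vs same inc))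

  length-≤-sharedSigns : ∀ {n} (v : Vec Sign n) ws {x : List (Vec (Fin t) n)} →
    IncreasingFor (v ∷ ws) x → length x ≤ t ^ sharedSigns v ws
  length-≤-sharedSigns []      ws {[]}          _ = z≤n
  length-≤-sharedSigns []      ws {_ ∷ []}      _ = s≤s z≤n
  length-≤-sharedSigns []      ws {[] ∷ [] ∷ _} (((() ∷ _) ∷ _) ∷ _)
  length-≤-sharedSigns (s ∷ v) ws {x} increasing@(incᵥ ∷ incs)
    with all? (λ w → head w ≟ˢ s) ws
  ... | yes _ = length-≤-fibres head x λ c →
    length-≤-via-tails ((s ∷ v) ∷ ws) (length-≤-sharedSigns v (map tail ws))
      (fibre-sameKey head c x)
      (All.map (AllPairs.filter⁺ _) increasing)
  ... | no disagree with All.lookupAny incs (All.¬All⇒Any¬ (λ w → head w ≟ˢ s) ws disagree)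
  ...   | incw , s'≢s =
    length-≤-via-tails ((s ∷ v) ∷ ws) (length-≤-sharedSigns v (map tail ws))
      (AllPairs.zipWith (uncurry (LexLess-opposite⇒head-≡ (s ∷ v) _ (s'≢s ∘ sym))) (incᵥ , incw))
      increasing

  length-≤-sharedSignsAfter : ∀ k {m} (v : Vec Sign (k + m)) ws {x : List (Vec (Fin t) (k + m))} →
    AllPairs (λ a b → take k a ≡ take k b) x → IncreasingFor (v ∷ ws) x →
    length x ≤ t ^ sharedSignsAfter k v ws
  length-≤-sharedSignsAfter zero    v ws _    increasing = length-≤-sharedSigns v ws increasing
  length-≤-sharedSignsAfter (suc k) v ws same increasing =
    length-≤-via-tails (v ∷ ws)
      (length-≤-sharedSignsAfter k (tail v) (map tail ws)
        (AllPairs.map⁺ (AllPairs.map (λ {a b} → proj₂ ∘ take-suc-≡⁻ k {a = a} {b}) same)))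
      (AllPairs.map (λ {a b} → proj₁ ∘ take-suc-≡⁻ k {a = a} {b}) same)
      increasing

module WithNonemptyAlphabet {t : ℕ} (t≥1 : 1 ≤ t) where

  commonSubseq-length-≤ : ∀ k {m} (v : Vec Sign (k + m)) ws {e} → sharedSignsAfter k v ws ≤ e →
    ∀ x → CommonSubseq x (map (πw t) (v ∷ ws)) → SamePrefix k x → length x ≤ t ^ e
  commonSubseq-length-≤ k v ws shared≤e x common samePrefix = ≤-trans
    (length-≤-sharedSignsAfter k v ws (AllPairs-tabulate samePrefix)
      (commonSubseq⇒increasing (v ∷ ws) common))
    (^-monoʳ-≤ t {{>-nonZero t≥1}} shared≤e)

  LCS≤-sharedSigns : ∀ {n} (v : Vec Sign n) ws {e} → sharedSigns v ws ≤ e →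
    LCS≤ (map (πw t) (v ∷ ws)) (t ^ e)
  LCS≤-sharedSigns v ws shared≤e x common =
    commonSubseq-length-≤ 0 v ws shared≤e x common (λ _ _ → refl)

  singleton-commonSubseq : ∀ {n} (vs : List (Vec Sign n)) →
    ∃ λ x → CommonSubseq x (map (πw t) vs) × length x ≡ 1
  singleton-commonSubseq {n} vs =
    [ a ] , All.map⁺ (All.universal (λ v → from∈ (∈-πw v a)) vs) , refl
    where
    a : Vec (Fin t) n
    a = replicate n (fromℕ< t≥1)

-- Since u is 8-periodic, each bound below reduces to a finite check over the phase i % 8.
u-resp-% : ∀ i j → i % 8 ≡ j % 8 → u i ≡ u j
u-resp-% i j eq = cong U (Finₚ.fromℕ<-cong (i % 8) (j % 8) eq (m%n<n i 8) (m%n<n j 8))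

u-mod : ∀ i → u i ≡ u (i % 8)
u-mod i = u-resp-% i (i % 8) (sym (m%n%n≡m%n i 8))

u-shift : ∀ i j → u (i + j) ≡ u (i % 8 + j)
u-shift i j = u-resp-% (i + j) (i % 8 + j) (begin
  (i + j) % 8                 ≡⟨ %-distribˡ-+ i j 8 ⟩
  (i % 8 + j % 8) % 8         ≡⟨ cong (λ r → (r + j % 8) % 8) (sym (m%n%n≡m%n i 8)) ⟩
  (i % 8 % 8 + j % 8) % 8     ≡⟨ sym (%-distribˡ-+ (i % 8) j 8) ⟩
  (i % 8 + j) % 8             ∎)
  where open ≡-Reasoning

_≟ᵘ_ : DecidableEquality (Vec Sign 8)
_≟ᵘ_ = ≡-dec _≟ˢ_

sharedSigns-consecutive : ∀ i → sharedSigns (u i) [ u (i + 1) ] ≤ 2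
sharedSigns-consecutive i rewrite u-mod i | u-shift i 1 = table (m%n<n i 8)
  where
  table : ∀ {a} → a < 8 → sharedSigns (u a) [ u (a + 1) ] ≤ 2
  table = from-yes (allUpTo? (λ a → sharedSigns (u a) [ u (a + 1) ] ≤? 2) 8)

sharedSigns-distinct : ∀ i j → u i ≢ u j → sharedSigns (u i) [ u j ] ≤ 4
sharedSigns-distinct i j rewrite u-mod i | u-mod j = table (m%n<n i 8) (m%n<n j 8)
  where
  table : ∀ {a} → a < 8 → ∀ {b} → b < 8 → u a ≢ u b → sharedSigns (u a) [ u b ] ≤ 4
  table = from-yes (allUpTo? (λ a → allUpTo? (λ b →
    ¬? (u a ≟ᵘ u b) →-dec sharedSigns (u a) [ u b ] ≤? 4) 8) 8)

sharedSigns-three-consecutive : ∀ i → sharedSigns (u i) (u (i + 1) ∷ u (i + 2) ∷ []) ≤ 0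
sharedSigns-three-consecutive i rewrite u-mod i | u-shift i 1 | u-shift i 2 = table (m%n<n i 8)
  where
  table : ∀ {a} → a < 8 → sharedSigns (u a) (u (a + 1) ∷ u (a + 2) ∷ []) ≤ 0
  table = from-yes (allUpTo? (λ a → sharedSigns (u a) (u (a + 1) ∷ u (a + 2) ∷ []) ≤? 0) 8)

sharedSigns-consecutive-other : ∀ i j → u j ≢ u i → u j ≢ u (i + 1) →
  sharedSigns (u i) (u (i + 1) ∷ u j ∷ []) ≤ 1
sharedSigns-consecutive-other i j rewrite u-mod i | u-shift i 1 | u-mod j =
  table (m%n<n i 8) (m%n<n j 8)
  where
  table : ∀ {a} → a < 8 → ∀ {b} → b < 8 → u b ≢ u a → u b ≢ u (a + 1) →
    sharedSigns (u a) (u (a + 1) ∷ u b ∷ []) ≤ 1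
  table = from-yes (allUpTo? (λ a → allUpTo? (λ b →
    ¬? (u b ≟ᵘ u a) →-dec ¬? (u b ≟ᵘ u (a + 1)) →-dec
    sharedSigns (u a) (u (a + 1) ∷ u b ∷ []) ≤? 1) 8) 8)

sharedSigns-distinct₃ : ∀ i j ℓ → u i ≢ u j → u i ≢ u ℓ → u j ≢ u ℓ →
  sharedSigns (u i) (u j ∷ u ℓ ∷ []) ≤ 2
sharedSigns-distinct₃ i j ℓ rewrite u-mod i | u-mod j | u-mod ℓ =
  table (m%n<n i 8) (m%n<n j 8) (m%n<n ℓ 8)
  where
  table : ∀ {a} → a < 8 → ∀ {b} → b < 8 → ∀ {c} → c < 8 →
    u a ≢ u b → u a ≢ u c → u b ≢ u c → sharedSigns (u a) (u b ∷ u c ∷ []) ≤ 2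
  table = from-yes (allUpTo? (λ a → allUpTo? (λ b → allUpTo? (λ c →
    ¬? (u a ≟ᵘ u b) →-dec ¬? (u a ≟ᵘ u c) →-dec ¬? (u b ≟ᵘ u c) →-dec
    sharedSigns (u a) (u b ∷ u c ∷ []) ≤? 2) 8) 8) 8)

sharedSignsAfter6-≤3-apart : ∀ i j → 1 ≤ j → j ≤ 3 → sharedSignsAfter 6 (u i) [ u (i + j) ] ≤ 1
sharedSignsAfter6-≤3-apart i j 1≤j j≤3 rewrite u-mod i | u-shift i j =
  table (m%n<n i 8) (s≤s j≤3) 1≤j
  where
  table : ∀ {a} → a < 8 → ∀ {b} → b < 4 → 1 ≤ b → sharedSignsAfter 6 (u a) [ u (a + b) ] ≤ 1
  table = from-yes (allUpTo? (λ a → allUpTo? (λ b →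
    1 ≤? b →-dec sharedSignsAfter 6 (u a) [ u (a + b) ] ≤? 1) 4) 8)

sharedSignsAfter5-apart : ∀ i j → 1 ≤ j → j ≤ 7 → sharedSignsAfter 5 (u i) [ u (i + j) ] ≤ 2
sharedSignsAfter5-apart i j 1≤j j≤7 rewrite u-mod i | u-shift i j =
  table (m%n<n i 8) (s≤s j≤7) 1≤j
  where
  table : ∀ {a} → a < 8 → ∀ {b} → b < 8 → 1 ≤ b → sharedSignsAfter 5 (u a) [ u (a + b) ] ≤ 2
  table = from-yes (allUpTo? (λ a → allUpTo? (λ b →
    1 ≤? b →-dec sharedSignsAfter 5 (u a) [ u (a + b) ] ≤? 2) 8) 8)

sharedSignsAfter3-apart : ∀ i j → 1 ≤ j → j ≤ 7 → sharedSignsAfter 3 (u i) [ u (i + j) ] ≤ 3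
sharedSignsAfter3-apart i j 1≤j j≤7 rewrite u-mod i | u-shift i j =
  table (m%n<n i 8) (s≤s j≤7) 1≤j
  where
  table : ∀ {a} → a < 8 → ∀ {b} → b < 8 → 1 ≤ b → sharedSignsAfter 3 (u a) [ u (a + b) ] ≤ 3
  table = from-yes (allUpTo? (λ a → allUpTo? (λ b →
    1 ≤? b →-dec sharedSignsAfter 3 (u a) [ u (a + b) ] ≤? 3) 8) 8)

proposition13 : (t : ℕ) → 1 ≤ t →
    (∀ i → 1 ≤ i →
        LCS≤ (πseq t i ∷ πseq t (i + 1) ∷ []) (t ^ 2))
    × (∀ i j → 1 ≤ i → 1 ≤ j → πseq t i ≢ πseq t j →
        LCS≤ (πseq t i ∷ πseq t j ∷ []) (t ^ 4))
    × (∀ i → 1 ≤ i →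
        LCS≤ (πseq t i ∷ πseq t (i + 1) ∷ πseq t (i + 2) ∷ []) 1
        × ∃ λ x → CommonSubseq x (πseq t i ∷ πseq t (i + 1) ∷ πseq t (i + 2) ∷ []) × length x ≡ 1)
    × (∀ i j → 1 ≤ i → 1 ≤ j → πseq t j ≢ πseq t i → πseq t j ≢ πseq t (i + 1) →
        LCS≤ (πseq t i ∷ πseq t (i + 1) ∷ πseq t j ∷ []) t)
    × (∀ i j ℓ → 1 ≤ i → 1 ≤ j → 1 ≤ ℓ →
        πseq t i ≢ πseq t j → πseq t i ≢ πseq t ℓ → πseq t j ≢ πseq t ℓ →
        LCS≤ (πseq t i ∷ πseq t j ∷ πseq t ℓ ∷ []) (t ^ 2))
    × (∀ i j → 1 ≤ i → 1 ≤ j → j ≤ 3 → ∀ x →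
        CommonSubseq x (πseq t i ∷ πseq t (i + j) ∷ []) → SamePrefix 6 x → length x ≤ t)
    × (∀ i j → 1 ≤ i → 1 ≤ j → j ≤ 7 → ∀ x →
        CommonSubseq x (πseq t i ∷ πseq t (i + j) ∷ []) → SamePrefix 5 x → length x ≤ t ^ 2)
    × (∀ i j → 1 ≤ i → 1 ≤ j → j ≤ 7 → ∀ x →
        CommonSubseq x (πseq t i ∷ πseq t (i + j) ∷ []) → SamePrefix 3 x → length x ≤ t ^ 3)
proposition13 t t≥1 =
    (λ i _ → lcs (u i) [ u (i + 1) ] (sharedSigns-consecutive i))
  , (λ i j _ _ π≢ → lcs (u i) [ u j ] (sharedSigns-distinct i j (u≢ i j π≢)))
  , (λ i _ → lcs (u i) (u (i + 1) ∷ u (i + 2) ∷ []) (sharedSigns-three-consecutive i)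
           , singleton-commonSubseq (u i ∷ u (i + 1) ∷ u (i + 2) ∷ []))
  , (λ i j _ _ π≢ π≢′ → subst (LCS≤ _) (^-identityʳ t)
        (lcs (u i) (u (i + 1) ∷ u j ∷ [])
          (sharedSigns-consecutive-other i j (u≢ j i π≢) (u≢ j (i + 1) π≢′))))
  , (λ i j ℓ _ _ _ π≢₁ π≢₂ π≢₃ → lcs (u i) (u j ∷ u ℓ ∷ [])
        (sharedSigns-distinct₃ i j ℓ (u≢ i j π≢₁) (u≢ i ℓ π≢₂) (u≢ j ℓ π≢₃)))
  , (λ i j _ 1≤j j≤3 x common same → subst (length x ≤_) (^-identityʳ t)
        (prefix 6 (u i) [ u (i + j) ] (sharedSignsAfter6-≤3-apart i j 1≤j j≤3) x common same))
  , (λ i j _ 1≤j j≤7 → prefix 5 (u i) [ u (i + j) ] (sharedSignsAfter5-apart i j 1≤j j≤7))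
  , (λ i j _ 1≤j j≤7 → prefix 3 (u i) [ u (i + j) ] (sharedSignsAfter3-apart i j 1≤j j≤7))
  where
  open WithNonemptyAlphabet t≥1 renaming (LCS≤-sharedSigns to lcs; commonSubseq-length-≤ to prefix)

  u≢ : ∀ i j → πseq t i ≢ πseq t j → u i ≢ u j
  u≢ _ _ π≢ = π≢ ∘ cong (πw t)
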